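{- Let $k\ge 1$ and consider a deck of $2^k$ cards. For any positions $0\le i,j\le 2^k-1$ there is a sequence of exactly $k$ horseshoe shuffles (each either in or out) that moves the card in position $i$ to position $j$. In particular, every card can be moved to the top position (position $0$) in at most $k$ horseshoe shuffles.
   Context: Positions in a deck of $2n$ cards are labeled $0,1,\ldots,2n-1$ from top to bottom. The out horseshoe shuffle: for $0\le j\le n-1$, the new position $2j$ receives the card previously at position $j$ and the new position $2j+1$ receives the card previously at position $2n-1-j$. The in horseshoe shuffle: for $0\le j\le n-1$, the new position $2j$ receives the card previously at position $2n-1-j$ and the new position $2j+1$ receives the card previously at position $j$. Here $2n=2^k$. -}

module Defs where

open import Data.Nat using (ℕ; zero; suc; _+_; _*_; _∸_; _<_)
open import Data.Nat.DivMod using (_/_; _%_)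
open import Data.List using (List; foldl)

-- A deck of 2n cards is modelled as a map from positions to cards;
-- only positions 0 .. 2n-1 (top = 0) are meaningful.
Deck : Set → Set
Deck A = ℕ → A

data Shuffle : Set where
  out-shuffle in-shuffle : Shuffle

shuffle : {A : Set} → (n : ℕ) → Shuffle → Deck A → Deck A
shuffle n out-shuffle d p with p % 2
... | zero  = d (p / 2)
... | suc _ = d (2 * n ∸ 1 ∸ p / 2)
shuffle n in-shuffle d p with p % 2
... | zero  = d (2 * n ∸ 1 ∸ p / 2)
... | suc _ = d (p / 2)

-- Apply a sequence of shuffles to a deck of 2n cards, head of the list first.
shuffles : {A : Set} → (n : ℕ) → List Shuffle → Deck A → Deck A
shuffles n ss d = foldl (λ e s → shuffle n s e) d ss

-- The initial deck: each card is labelled by its starting position.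
initial : Deck ℕ
initial p = p

module Submission where

-- Reading a shuffle backwards, the card now at position p of a
-- deck of N = 2n cards came from position ⌊p/2⌋ or from N-1-⌊p/2⌋, and for
-- every p each of the two is realised by one of the two shuffles (which one
-- depends on the parity of p).  Cut the positions 0 .. N-1 into 2^m blocks
-- of length 2^a (2^m · 2^a = N).  By induction on m, after m suitable
-- shuffles the card at position j can come from any prescribed block t:
-- to land in block t < 2^(m-1) halve a position lying in block t of the
-- blocks twice as long; for t ≥ 2^(m-1) halve a position lying in the
-- mirrored block 2^m-1-t and then reflect by x ↦ N-1-x.  With m = k the
-- blocks have length 1, which gives the theorem.

open import Defs
open import Data.Nat using (ℕ; _≥_; _<_; _^_; _∸_; zero; suc; _+_; _*_; s≤s; z≤n)
open import Data.Nat.DivMod using (_/_; _%_; +-distrib-/-∣ˡ; m*n/n≡m; m<n*o⇒m/o<n)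
open import Data.Nat.Divisibility using (divides-refl)
open import Data.Nat.Properties
open import Data.Nat.Tactic.RingSolver using (solve-∀)
open import Data.List using (List; length; []; _∷_)
open import Data.Product using (∃; _×_; _,_)
open import Data.Sum using (_⊎_; inj₁; inj₂)
open import Relation.Nullary using (yes; no)
open import Relation.Binary.PropositionalEquality

shuffle-natural : ∀ {A : Set} n s (d : Deck A) p → shuffle n s d p ≡ d (shuffle n s initial p)
shuffle-natural n out-shuffle d p with p % 2
... | zero  = refl
... | suc _ = refl
shuffle-natural n in-shuffle d p with p % 2
... | zero  = refl
... | suc _ = refl

shuffles-natural : ∀ {A : Set} n ss (d : Deck A) p → shuffles n ss d p ≡ d (shuffles n ss initial p)
shuffles-natural n [] d p = refl
shuffles-natural n (s ∷ ss) d p = begin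
  shuffles n ss (shuffle n s d) p                   ≡⟨ shuffles-natural n ss (shuffle n s d) p ⟩
  shuffle n s d (shuffles n ss initial p)           ≡⟨ shuffle-natural n s d _ ⟩
  d (shuffle n s initial (shuffles n ss initial p)) ≡⟨ cong d (shuffles-natural n ss (shuffle n s initial) p) ⟨
  d (shuffles n ss (shuffle n s initial) p)         ∎
  where open ≡-Reasoning

shuffles-cons : ∀ n s ss p →
  shuffles n (s ∷ ss) initial p ≡ shuffle n s initial (shuffles n ss initial p)
shuffles-cons n s ss p = shuffles-natural n ss (shuffle n s initial) p

Halves Reflects : ℕ → Shuffle → ℕ → Set
Halves   n s p = shuffle n s initial p ≡ p / 2
Reflects n s p = shuffle n s initial p ≡ 2 * n ∸ 1 ∸ p / 2

halves-and-reflects : ∀ n p →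
  (Halves n out-shuffle p × Reflects n in-shuffle p) ⊎ (Halves n in-shuffle p × Reflects n out-shuffle p)
halves-and-reflects n p with p % 2
... | zero  = inj₁ (refl , refl)
... | suc _ = inj₂ (refl , refl)

halving-shuffle : ∀ n p → ∃ λ s → Halves n s p
halving-shuffle n p with halves-and-reflects n p
... | inj₁ (halves , _) = out-shuffle , halves
... | inj₂ (halves , _) = in-shuffle , halves

reflecting-shuffle : ∀ n p → ∃ λ s → Reflects n s p
reflecting-shuffle n p with halves-and-reflects n p
... | inj₁ (_ , reflects) = in-shuffle , reflects
... | inj₂ (_ , reflects) = out-shuffle , reflects

InBlock : ℕ → ℕ → ℕ → Set
InBlock P t x = ∃ λ r → r < P × x ≡ t * P + r

halve-block : ∀ P t x → InBlock (2 * P) t x → InBlock P t (x / 2)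
halve-block P t .(t * (2 * P) + r) (r , r< , refl) = r / 2 , r/2< , (begin
  (t * (2 * P) + r) / 2 ≡⟨ cong (λ z → (z + r) / 2) (regroup t P) ⟩
  (t * P * 2 + r) / 2   ≡⟨ +-distrib-/-∣ˡ r (divides-refl (t * P)) ⟩
  t * P * 2 / 2 + r / 2 ≡⟨ cong (_+ r / 2) (m*n/n≡m (t * P) 2) ⟩
  t * P + r / 2         ∎)
  where
  open ≡-Reasoning
  regroup : ∀ t P → t * (2 * P) ≡ t * P * 2
  regroup = solve-∀
  r/2< : r / 2 < P
  r/2< = m<n*o⇒m/o<n (subst (r <_) (*-comm 2 P) r<)

∸-suc-cancel : ∀ A z y → A ≡ z + suc y → A ∸ 1 ∸ y ≡ z
∸-suc-cancel .(z + suc y) z y refl rewrite +-suc z y = m+n∸n≡m z y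

mirror-block : ∀ M P t t' y → t + suc t' ≡ M → InBlock P t y → InBlock P t' (M * P ∸ 1 ∸ y)
mirror-block .(t + suc t') P t t' .(t * P + r) refl (r , r< , refl) =
  u , u<P , ∸-suc-cancel ((t + suc t') * P) (t' * P + u) (t * P + r) total
  where
  u = P ∸ suc r
  u+r+1≡P : u + suc r ≡ P
  u+r+1≡P = m∸n+n≡m r<
  u<P : u < P
  u<P = subst (u <_) u+r+1≡P (m<m+n u (s≤s z≤n))
  split : ∀ t t' u r → (t + suc t') * (u + suc r) ≡ (t' * (u + suc r) + u) + suc (t * (u + suc r) + r)
  split = solve-∀
  total : (t + suc t') * P ≡ (t' * P + u) + suc (t * P + r)
  total = subst (λ P → (t + suc t') * P ≡ (t' * P + u) + suc (t * P + r)) u+r+1≡P (split t t' u r)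

-- Splitting each block of length 2P in two doubles the number of blocks.
halves-regroup : ∀ M P → M * (2 * P) ≡ 2 * M * P
halves-regroup = solve-∀

lower-or-mirror : ∀ m t → t < 2 ^ suc m →
  t < 2 ^ m ⊎ ∃ λ t' → t' < 2 ^ m × t' + suc t ≡ 2 ^ suc m
lower-or-mirror m t t< with t <? 2 ^ m
... | yes t<half = inj₁ t<half
... | no t≮half = inj₂ (t' , t'<half , m∸n+n≡m t<)
  where
  open ≤-Reasoning
  t' = 2 ^ suc m ∸ suc t
  t'<half : t' < 2 ^ m
  t'<half = +-cancelʳ-< (2 ^ m) t' (2 ^ m) (begin-strict
    t' + 2 ^ m     <⟨ +-monoʳ-< t' (s≤s (≮⇒≥ t≮half)) ⟩
    t' + suc t     ≡⟨ m∸n+n≡m t< ⟩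
    2 ^ suc m      ≡⟨ cong (2 ^ m +_) (+-identityʳ (2 ^ m)) ⟩
    2 ^ m + 2 ^ m  ∎)

reach-block : ∀ n m a → 2 ^ m * 2 ^ a ≡ 2 * n → ∀ j → j < 2 * n → ∀ t → t < 2 ^ m →
  ∃ λ (ss : List Shuffle) → length ss ≡ m × InBlock (2 ^ a) t (shuffles n ss initial j)
reach-block n zero a eq j j< zero _ =
  [] , refl , j , subst (j <_) (sym (trans (sym (+-identityʳ (2 ^ a))) eq)) j< , refl
reach-block n zero a eq j j< (suc t) (s≤s ())
reach-block n (suc m) a eq j j< t t< with lower-or-mirror m t t<
... | inj₁ t<half
  with reach-block n m (suc a) (trans (halves-regroup (2 ^ m) (2 ^ a)) eq) j j< t t<half
... | ss , len , inBlock with halving-shuffle n (shuffles n ss initial j)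
... | s , halves = s ∷ ss , cong suc len ,
      subst (InBlock (2 ^ a) t) (sym (trans (shuffles-cons n s ss j) halves))
            (halve-block (2 ^ a) t _ inBlock)
reach-block n (suc m) a eq j j< t t< | inj₂ (t' , t'<half , mirrors)
  with reach-block n m (suc a) (trans (halves-regroup (2 ^ m) (2 ^ a)) eq) j j< t' t'<half
... | ss , len , inBlock with reflecting-shuffle n (shuffles n ss initial j)
... | s , reflects = s ∷ ss , cong suc len ,
      subst (InBlock (2 ^ a) t)
            (trans (cong (λ N → N ∸ 1 ∸ shuffles n ss initial j / 2) eq)
                   (sym (trans (shuffles-cons n s ss j) reflects)))
            (mirror-block (2 ^ suc m) (2 ^ a) t' t _ mirrors
                          (halve-block (2 ^ a) t' _ inBlock))

unit-block : ∀ t x → InBlock 1 t x → x ≡ t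
unit-block t .(t * 1 + 0) (zero , _ , refl) = trans (+-identityʳ (t * 1)) (*-identityʳ t)
unit-block t _ (suc _ , s≤s () , _)

proposition1 : (k : ℕ) → k ≥ 1 → (i j : ℕ) → i < 2 ^ k → j < 2 ^ k →
    ∃ λ (ss : List Shuffle) → length ss ≡ k × shuffles (2 ^ (k ∸ 1)) ss initial j ≡ i
proposition1 (suc k) _ i j i< j<
  with reach-block (2 ^ k) (suc k) 0 (*-identityʳ (2 ^ suc k)) j j< i i<
... | ss , len , inBlock = ss , len , unit-block i _ inBlock
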